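{- In the theory TRC, for all $x$: (a) $\mathrm{Abst}(\mathrm{Abst}(\mathrm{Abst}\,x)) = \mathrm{Abst}\,x$; (b) $\mathrm{Abst}(\mathrm{Abst}\,K(x)) = K(x)$; (c) $\mathrm{Abst}\,K(K(x)) = K(K(x))$.
   Context: TRC is the following first-order theory (a system of illative combinatory logic). Its objects are "combinators". The language has a binary operation of application, written by juxtaposition $xy$ (meaning $x$ applied to $y$), with the convention that application associates to the left, i.e. $xyz=(xy)z$; constants $\mathrm{Abst}$, $\mathrm{Eq}$, $p_1$, $p_2$; a binary function symbol $\mathrm{pair}(x,y)$, written $\langle x,y\rangle$; and a unary function symbol $K$ (so $K(x)$ is a term for each term $x$; $K$ is not itself a combinator). The axioms are: I. $K(x)\,y = x$; II. $p_1\langle x_1,x_2\rangle = x_1$ and $p_2\langle x_1,x_2\rangle = x_2$; III. $\langle p_1 x, p_2 x\rangle = x$; IV. $\langle f,g\rangle x = \langle fx, gx\rangle$; V. $\mathrm{Abst}\,x\,y\,z = x\,K(z)\,(y\,z)$; VI. $\mathrm{Eq}\langle x,y\rangle = p_1$ if $x=y$, and $\mathrm{Eq}\langle x,y\rangle = p_2$ if $x\neq y$; VII. (extensionality) if $fx=gx$ for all $x$, then $f=g$; VIII. $p_1\neq p_2$. In (b), $\mathrm{Abst}(\mathrm{Abst}\,K(x))$ means $\mathrm{Abst}$ applied to the combinator $\mathrm{Abst}\,K(x)$ (i.e. $\mathrm{Abst}$ applied to $K(x)$); in (c), $\mathrm{Abst}\,K(K(x))$ means $\mathrm{Abst}$ applied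 to $K(K(x))$. The claim asserts that these equations are theorems of TRC. -}

module Defs where

open import Level using (Level; suc)
open import Relation.Binary.PropositionalEquality using (_≡_)
open import Relation.Nullary using (¬_)

record TRC (ℓ : Level) : Set (suc ℓ) where
  infixl 9 _·_
  field
    C     : Set ℓ
    _·_   : C → C → C
    Abst  : C
    Eq    : C
    p₁    : C
    p₂    : C
    pair  : C → C → C
    K     : C → C
    ax-K     : ∀ x y → K x · y ≡ x
    ax-p₁    : ∀ x₁ x₂ → p₁ · pair x₁ x₂ ≡ x₁
    ax-p₂    : ∀ x₁ x₂ → p₂ · pair x₁ x₂ ≡ x₂
    ax-surj  : ∀ x → pair (p₁ · x) (p₂ · x) ≡ x
    ax-pairapp : ∀ f g x → pair f g · x ≡ pair (f · x) (g · x)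
    ax-Abst  : ∀ x y z → Abst · x · y · z ≡ x · K z · (y · z)
    ax-Eq₁   : ∀ x y → x ≡ y → Eq · pair x y ≡ p₁
    ax-Eq₂   : ∀ x y → ¬ (x ≡ y) → Eq · pair x y ≡ p₂
    ax-ext   : ∀ f g → (∀ x → f · x ≡ g · x) → f ≡ g
    ax-p₁≢p₂ : ¬ (p₁ ≡ p₂)

{-# OPTIONS --safe #-}
module Submission where

open import Defs
open import Level using (Level)
open import Data.Product using (_×_; _,_)
open import Relation.Binary.PropositionalEquality using (_≡_; cong; module ≡-Reasoning)

-- Only axioms I (K), V (Abst) and VII (extensionality) are needed.  By V and I,
-- Abst (Abst f) y z = f K(yz) z and Abst K(f) y z = f (yz); each equation then
-- follows by applying both sides to two arguments and using extensionality.

module Abstraction {ℓ : Level} (T : TRC ℓ) where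
  open TRC T
  open ≡-Reasoning

  ·-ext₂ : ∀ f g → (∀ y z → f · y · z ≡ g · y · z) → f ≡ g
  ·-ext₂ f g f≗g = ax-ext f g (λ y → ax-ext (f · y) (g · y) (f≗g y))

  Abst-Abst-· : ∀ f y z → Abst · (Abst · f) · y · z ≡ f · K (y · z) · z
  Abst-Abst-· f y z = begin
    Abst · (Abst · f) · y · z        ≡⟨ ax-Abst (Abst · f) y z ⟩
    Abst · f · K z · (y · z)         ≡⟨ ax-Abst f (K z) (y · z) ⟩
    f · K (y · z) · (K z · (y · z))  ≡⟨ cong (f · K (y · z) ·_) (ax-K z (y · z)) ⟩
    f · K (y · z) · z                ∎

  Abst-K-· : ∀ f y z → Abst · K f · y · z ≡ f · (y · z)
  Abst-K-· f y z = begin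
    Abst · K f · y · z      ≡⟨ ax-Abst (K f) y z ⟩
    K f · K z · (y · z)     ≡⟨ cong (_· (y · z)) (ax-K f (K z)) ⟩
    f · (y · z)             ∎

  Abst-Abst-Abst : ∀ x → Abst · (Abst · (Abst · x)) ≡ Abst · x
  Abst-Abst-Abst x = ·-ext₂ _ _ λ y z → begin
    Abst · (Abst · (Abst · x)) · y · z  ≡⟨ Abst-Abst-· (Abst · x) y z ⟩
    Abst · x · K (y · z) · z            ≡⟨ ax-Abst x (K (y · z)) z ⟩
    x · K z · (K (y · z) · z)           ≡⟨ cong (x · K z ·_) (ax-K (y · z) z) ⟩
    x · K z · (y · z)                   ≡⟨ ax-Abst x y z ⟨
    Abst · x · y · z                    ∎

  Abst-Abst-K : ∀ x → Abst · (Abst · K x) ≡ K x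
  Abst-Abst-K x = ·-ext₂ _ _ λ y z → begin
    Abst · (Abst · K x) · y · z  ≡⟨ Abst-Abst-· (K x) y z ⟩
    K x · K (y · z) · z          ≡⟨ cong (_· z) (ax-K x (K (y · z))) ⟩
    x · z                        ≡⟨ cong (_· z) (ax-K x y) ⟨
    K x · y · z                  ∎

  Abst-K-K : ∀ x → Abst · K (K x) ≡ K (K x)
  Abst-K-K x = ·-ext₂ _ _ λ y z → begin
    Abst · K (K x) · y · z  ≡⟨ Abst-K-· (K x) y z ⟩
    K x · (y · z)           ≡⟨ ax-K x (y · z) ⟩
    x                       ≡⟨ ax-K x z ⟨
    K x · z                 ≡⟨ cong (_· z) (ax-K (K x) y) ⟨
    K (K x) · y · z         ∎

proposition2 : ∀ {ℓ : Level} (T : TRC ℓ) → let open TRC T in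
    ∀ x →
      (Abst · (Abst · (Abst · x)) ≡ Abst · x)
      × (Abst · (Abst · K x) ≡ K x)
      × (Abst · K (K x) ≡ K (K x))
proposition2 T x = Abst-Abst-Abst x , Abst-Abst-K x , Abst-K-K x
  where open Abstraction T
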